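{- Let $G$ be a graph with vertex set $V=\{v_1,\dots,v_n\}$ and adjacency matrix $A=\begin{pmatrix}P&Q\\ Q^T&R\end{pmatrix}$ in the basis $(v_1,\dots,v_n)$, where $P$ is the block on rows and columns $W=\{v_1,\dots,v_k\}$. Suppose $W$ is reducible in $G$, and let $M$ be any matrix with $Q=PM$. Then the adjacency matrix of $\Gamma_W(G)$ in the basis $(v_{k+1},\dots,v_n)$ is $R-M^TPM$. If $P$ is invertible, this matrix equals $R-Q^TP^{ -1}Q$.
   Context: A graph is a finite graph with vertex set $V$, no multiple edges, in which each vertex may or may not carry a loop. Its adjacency matrix $A$ is the symmetric $V\times V$ matrix over $\mathbf{F}_2$ with $A_{vw}=1$ iff $v\ne w$ are adjacent and $A_{vv}=1$ iff $v$ has a loop; all matrices are over $\mathbf{F}_2$. Let $\mathcal{V}$ be the $\mathbf{F}_2$-vector space with basis $V$ and $\mathcal{E}(x,y)=x^TAy$. For $W\subseteq V$, $\langle W\rangle$ is the span of $W$ and $\langle W\rangle^{\perp}=\{x:\mathcal{E}(x,w)=0\ \forall w\in\langle W\rangle\}$. $W$ is reducible in $G$ if $\langle W\rangle+\langle W\rangle^{\perp}=\mathcal{V}$ (equivalently, such an $M$ with $Q=PM$ exists). For reducible $W$, $\Gamma_W(G)$ is the graph on $V\setminus W$ in which $v,w\in V\setminus W$ (possibly $v=w$, concerning a loop) are adjacent iff $\mathcal{E}(v',w')=1$, where $v',w'\in\langle W\rangle^{\perp}$ are any vectors with $v-v',w-w'\in\langle W\rangle$ (the value is independent of the choice). -}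

module Defs where

open import Data.Bool using (Bool; true; false; _xor_; _∧_)
open import Data.Nat using (ℕ; zero; suc; _+_)
open import Data.Fin using (Fin; zero; suc; _↑ˡ_; _↑ʳ_)
open import Data.Fin.Properties using (_≟_)
open import Data.Product using (Σ; _×_; _,_; proj₁; proj₂)
open import Relation.Binary.PropositionalEquality using (_≡_)
open import Relation.Nullary using (does)

-- The field F₂ is modelled by Bool: addition (= subtraction) is _xor_,
-- multiplication is _∧_.

Σ₂ : {n : ℕ} → (Fin n → Bool) → Bool
Σ₂ {zero}  f = false
Σ₂ {suc n} f = f zero xor Σ₂ (λ i → f (suc i))

Matrix : ℕ → ℕ → Set
Matrix m n = Fin m → Fin n → Bool

Vector : ℕ → Set
Vector n = Fin n → Bool

_ᵀ : {m n : ℕ} → Matrix m n → Matrix n m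
(A ᵀ) i j = A j i

_·_ : {m n p : ℕ} → Matrix m n → Matrix n p → Matrix m p
(A · B) i j = Σ₂ (λ l → A i l ∧ B l j)

_−_ : {m n : ℕ} → Matrix m n → Matrix m n → Matrix m n
(A − B) i j = A i j xor B i j

identity : {n : ℕ} → Matrix n n
identity i j = does (i ≟ j)

_≐_ : {m n : ℕ} → Matrix m n → Matrix m n → Set
A ≐ B = ∀ i j → A i j ≡ B i j

_+ᵥ_ : {n : ℕ} → Vector n → Vector n → Vector n
(x +ᵥ y) i = x i xor y i

e : {n : ℕ} → Fin n → Vector n
e i j = does (i ≟ j)

-- A graph on the vertex set Fin n (vertices v₁,…,vₙ in this order),
-- possibly with loops, no multiple edges: a symmetric adjacency relation
-- valued in Bool (adj v v = true iff v carries a loop).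
record Graph (n : ℕ) : Set where
  field
    adj : Fin n → Fin n → Bool
    adj-sym : ∀ v w → adj v w ≡ adj w v

open Graph public

adjMatrix : {n : ℕ} → Graph n → Matrix n n
adjMatrix G = adj G

ℰ : {n : ℕ} → Graph n → Vector n → Vector n → Bool
ℰ G x y = Σ₂ (λ i → Σ₂ (λ j → x i ∧ (adjMatrix G i j ∧ y j)))

-- Throughout, V = Fin (k + m) and W = {v₁,…,v_k} = the first k vertices
-- (indices i ↑ˡ m), V ∖ W = the last m vertices (indices k ↑ʳ j).

-- x ∈ ⟨W⟩ : x is a linear combination of the basis vectors in W,
-- i.e. its coordinates outside W vanish.
InSpanW : (k m : ℕ) → Vector (k + m) → Set
InSpanW k m x = ∀ (j : Fin m) → x (k ↑ʳ j) ≡ false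

InPerpW : {k m : ℕ} → Graph (k + m) → Vector (k + m) → Set
InPerpW {k} {m} G x = ∀ w → InSpanW k m w → ℰ G x w ≡ false

-- W reducible: ⟨W⟩ + ⟨W⟩^⊥ = 𝒱, i.e. every x is a + b with a ∈ ⟨W⟩, b ∈ ⟨W⟩^⊥.
Reducible : (k m : ℕ) → Graph (k + m) → Set
Reducible k m G = ∀ (x : Vector (k + m)) →
  Σ (Vector (k + m)) λ a → Σ (Vector (k + m)) λ b →
    InSpanW k m a × InPerpW {k} {m} G b × (∀ i → x i ≡ (a +ᵥ b) i)

-- For v ∈ V ∖ W, a vector v' ∈ ⟨W⟩^⊥ with v − v' ∈ ⟨W⟩, chosen via the
-- reducibility witness (the paper shows the resulting adjacency does not
-- depend on the choice; here the witness is arbitrary).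
perpRep : {k m : ℕ} (G : Graph (k + m)) → Reducible k m G → Fin m → Vector (k + m)
perpRep {k} G red j = proj₁ (proj₂ (red (e (k ↑ʳ j))))

ΓAdj : {k m : ℕ} (G : Graph (k + m)) → Reducible k m G → Matrix m m
ΓAdj G red i j = ℰ G (perpRep G red i) (perpRep G red j)

blockP : (k m : ℕ) → Graph (k + m) → Matrix k k
blockP k m G i j = adjMatrix G (i ↑ˡ m) (j ↑ˡ m)

blockQ : (k m : ℕ) → Graph (k + m) → Matrix k m
blockQ k m G i j = adjMatrix G (i ↑ˡ m) (k ↑ʳ j)

blockR : (k m : ℕ) → Graph (k + m) → Matrix m m
blockR k m G i j = adjMatrix G (k ↑ʳ i) (k ↑ʳ j)

module Submission where

-- For each vertex vₖ₊ᵢ outside W, reducibility supplies a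
-- representative bᵢ ∈ ⟨W⟩^⊥ with bᵢ − vₖ₊ᵢ ∈ ⟨W⟩.  Collect these as the rows
-- of an m × (k+m) matrix B = [α | I], where α holds the W-coordinates.  Then
--   * Γ_W(G) has matrix B A Bᵀ (ℰ is the form of A);
--   * B ⊥ ⟨W⟩ says that the first k columns of B A = [αP + Qᵀ | αQ + R] vanish,
--     i.e. αP = Qᵀ, and consequently B A Bᵀ = αQ + R;
--   * from Q = PM and P = Pᵀ:  αQ = αPM = QᵀM = MᵀPᵀM = MᵀPM.
-- If P⁻¹P = I, then likewise QᵀP⁻¹Q = QᵀP⁻¹PM = QᵀM = MᵀPM.
-- Over F₂ subtraction is addition, so R − X and X − R are the same matrix.

open import Defs
open import Algebra.Bundles using (CommutativeRing)
open import Data.Bool using (Bool; true; false; _xor_; _∧_)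
open import Data.Bool.Properties
  using (xor-∧-commutativeRing; xor-assoc; xor-comm; xor-identityʳ; ∧-comm; ∧-assoc;
         ∧-zeroʳ; ∧-identityʳ; ∧-distribˡ-xor)
open import Data.Fin using (Fin; zero; suc; _↑ˡ_; _↑ʳ_; splitAt)
open import Data.Fin.Properties using (_≟_; ↑ʳ-injective; splitAt-↑ˡ; splitAt-↑ʳ)
open import Data.Nat using (ℕ; zero; suc; _+_)
open import Data.Product using (_×_; _,_; proj₁; proj₂)
open import Level using (0ℓ)
open import Relation.Binary.Bundles using (Setoid)
open import Relation.Binary.PropositionalEquality
open import Relation.Nullary using (yes; no; ¬_)
open import Relation.Nullary.Decidable using (dec-true; dec-false)
open import Algebra.Properties.CommutativeSemigroup
  (CommutativeRing.+-commutativeSemigroup xor-∧-commutativeRing) using (interchange)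
import Relation.Binary.Reasoning.Setoid as SetoidReasoning

xor≡false⇒≡ : ∀ x y → x xor y ≡ false → x ≡ y
xor≡false⇒≡ false false _ = refl
xor≡false⇒≡ true  true  _ = refl

Σ-cong : ∀ {n} {f g : Fin n → Bool} → (∀ i → f i ≡ g i) → Σ₂ f ≡ Σ₂ g
Σ-cong {zero}  _ = refl
Σ-cong {suc n} p = cong₂ _xor_ (p zero) (Σ-cong (λ i → p (suc i)))

Σ-zero : ∀ {n} → Σ₂ {n} (λ _ → false) ≡ false
Σ-zero {zero}  = refl
Σ-zero {suc n} = Σ-zero {n}

Σ-xor : ∀ {n} (f g : Fin n → Bool) → Σ₂ (λ i → f i xor g i) ≡ Σ₂ f xor Σ₂ g
Σ-xor {zero}  f g = refl
Σ-xor {suc n} f g = begin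
  (f zero xor g zero) xor Σ₂ (λ i → f (suc i) xor g (suc i))
    ≡⟨ cong ((f zero xor g zero) xor_) (Σ-xor (λ i → f (suc i)) (λ i → g (suc i))) ⟩
  (f zero xor g zero) xor (Σ₂ (λ i → f (suc i)) xor Σ₂ (λ i → g (suc i)))
    ≡⟨ interchange (f zero) (g zero) _ _ ⟩
  Σ₂ f xor Σ₂ g ∎
  where open ≡-Reasoning

Σ-∧ˡ : ∀ {n} c (f : Fin n → Bool) → c ∧ Σ₂ f ≡ Σ₂ (λ i → c ∧ f i)
Σ-∧ˡ {zero}  c f = ∧-zeroʳ c
Σ-∧ˡ {suc n} c f = trans (∧-distribˡ-xor c (f zero) _)
  (cong ((c ∧ f zero) xor_) (Σ-∧ˡ c (λ i → f (suc i))))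

Σ-∧ʳ : ∀ {n} c (f : Fin n → Bool) → Σ₂ f ∧ c ≡ Σ₂ (λ i → f i ∧ c)
Σ-∧ʳ c f = trans (∧-comm _ c) (trans (Σ-∧ˡ c f) (Σ-cong (λ i → ∧-comm c (f i))))

Σ-swap : ∀ {n p} (f : Fin n → Fin p → Bool) →
  Σ₂ (λ i → Σ₂ (λ j → f i j)) ≡ Σ₂ (λ j → Σ₂ (λ i → f i j))
Σ-swap {zero}  {p} f = sym (Σ-zero {p})
Σ-swap {suc n}     f = trans (cong (Σ₂ (f zero) xor_) (Σ-swap (λ i → f (suc i))))
  (sym (Σ-xor (f zero) (λ j → Σ₂ (λ i → f (suc i) j))))

Σ-split : ∀ k m (f : Fin (k + m) → Bool) →
  Σ₂ f ≡ Σ₂ (λ l → f (l ↑ˡ m)) xor Σ₂ (λ t → f (k ↑ʳ t))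
Σ-split zero    m f = refl
Σ-split (suc k) m f = trans (cong (f zero xor_) (Σ-split k m (λ i → f (suc i))))
  (sym (xor-assoc (f zero) _ _))

Σ-pick : ∀ {n} (i : Fin n) (f : Fin n → Bool) → Σ₂ (λ j → f j ∧ e i j) ≡ f i
Σ-pick {suc n} zero f = begin
  (f zero ∧ true) xor Σ₂ (λ j → f (suc j) ∧ false)
    ≡⟨ cong₂ _xor_ (∧-identityʳ (f zero)) (Σ-cong (λ j → ∧-zeroʳ (f (suc j)))) ⟩
  f zero xor Σ₂ {n} (λ _ → false)
    ≡⟨ cong (f zero xor_) (Σ-zero {n}) ⟩
  f zero xor false
    ≡⟨ xor-identityʳ (f zero) ⟩
  f zero ∎
  where open ≡-Reasoning
Σ-pick {suc n} (suc i) f = trans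
  (cong (_xor Σ₂ (λ j → f (suc j) ∧ e i j)) (∧-zeroʳ (f zero)))
  (Σ-pick i (λ j → f (suc j)))

≐-refl : ∀ {m n} {A : Matrix m n} → A ≐ A
≐-refl i j = refl

≐-sym : ∀ {m n} {A B : Matrix m n} → A ≐ B → B ≐ A
≐-sym p i j = sym (p i j)

≐-trans : ∀ {m n} {A B C : Matrix m n} → A ≐ B → B ≐ C → A ≐ C
≐-trans p q i j = trans (p i j) (q i j)

≐-setoid : ℕ → ℕ → Setoid 0ℓ 0ℓ
≐-setoid m n = record
  { Carrier       = Matrix m n
  ; _≈_           = _≐_
  ; isEquivalence = record { refl = ≐-refl ; sym = ≐-sym ; trans = ≐-trans } }

·-cong : ∀ {m n p} {A A' : Matrix m n} {B B' : Matrix n p} →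
  A ≐ A' → B ≐ B' → (A · B) ≐ (A' · B')
·-cong pa pb i j = Σ-cong (λ l → cong₂ _∧_ (pa i l) (pb l j))

·-congˡ : ∀ {m n p} (A : Matrix m n) {B B' : Matrix n p} → B ≐ B' → (A · B) ≐ (A · B')
·-congˡ A = ·-cong (≐-refl {A = A})

·-congʳ : ∀ {m n p} {A A' : Matrix m n} (B : Matrix n p) → A ≐ A' → (A · B) ≐ (A' · B)
·-congʳ B p = ·-cong p (≐-refl {A = B})

·-assoc : ∀ {m n p q} (A : Matrix m n) (B : Matrix n p) (C : Matrix p q) →
  ((A · B) · C) ≐ (A · (B · C))
·-assoc A B C i j = begin
  Σ₂ (λ l → Σ₂ (λ a → A i a ∧ B a l) ∧ C l j)
    ≡⟨ Σ-cong (λ l → Σ-∧ʳ (C l j) (λ a → A i a ∧ B a l)) ⟩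
  Σ₂ (λ l → Σ₂ (λ a → (A i a ∧ B a l) ∧ C l j))
    ≡⟨ Σ-swap (λ l a → (A i a ∧ B a l) ∧ C l j) ⟩
  Σ₂ (λ a → Σ₂ (λ l → (A i a ∧ B a l) ∧ C l j))
    ≡⟨ Σ-cong (λ a → Σ-cong (λ l → ∧-assoc (A i a) (B a l) (C l j))) ⟩
  Σ₂ (λ a → Σ₂ (λ l → A i a ∧ (B a l ∧ C l j)))
    ≡⟨ Σ-cong (λ a → sym (Σ-∧ˡ (A i a) (λ l → B a l ∧ C l j))) ⟩
  Σ₂ (λ a → A i a ∧ Σ₂ (λ l → B a l ∧ C l j)) ∎
  where open ≡-Reasoning

ᵀ-· : ∀ {m n p} (A : Matrix m n) (B : Matrix n p) → ((A · B) ᵀ) ≐ ((B ᵀ) · (A ᵀ))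
ᵀ-· A B i j = Σ-cong (λ l → ∧-comm (A j l) (B l i))

identity-sym : ∀ {n} → (identity {n} ᵀ) ≐ identity
identity-sym i j with i ≟ j
... | yes refl = dec-true (i ≟ i) refl
... | no  i≢j  = dec-false (j ≟ i) (λ j≡i → i≢j (sym j≡i))

·-identityʳ : ∀ {m n} (A : Matrix m n) → (A · identity) ≐ A
·-identityʳ A i j = trans (Σ-cong (λ l → cong (A i l ∧_) (identity-sym j l))) (Σ-pick j (A i))

·-identityˡ : ∀ {m n} (A : Matrix m n) → (identity · A) ≐ A
·-identityˡ A i j = trans (Σ-cong (λ l → ∧-comm (identity i l) (A l j))) (Σ-pick i (λ l → A l j))

−-cong : ∀ {m n} {X X' Y Y' : Matrix m n} → X ≐ X' → Y ≐ Y' → (X − Y) ≐ (X' − Y')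
−-cong p q i j = cong₂ _xor_ (p i j) (q i j)

−-comm : ∀ {m n} (X Y : Matrix m n) → (X − Y) ≐ (Y − X)
−-comm X Y i j = xor-comm (X i j) (Y i j)

leftCols : ∀ {p} k m → Matrix p (k + m) → Matrix p k
leftCols k m X i l = X i (l ↑ˡ m)

rightCols : ∀ {p} k m → Matrix p (k + m) → Matrix p m
rightCols k m X i t = X i (k ↑ʳ t)

topRows : ∀ {q} k m → Matrix (k + m) q → Matrix k q
topRows k m Y l j = Y (l ↑ˡ m) j

bottomRows : ∀ {q} k m → Matrix (k + m) q → Matrix m q
bottomRows k m Y t j = Y (k ↑ʳ t) j

·-blocks : ∀ {p q} k m (X : Matrix p (k + m)) (Y : Matrix (k + m) q) →
  (X · Y) ≐ ((leftCols k m X · topRows k m Y) − (rightCols k m X · bottomRows k m Y))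
·-blocks k m X Y i j = Σ-split k m (λ v → X i v ∧ Y v j)

↑ˡ≢↑ʳ : ∀ k m (l : Fin k) (t : Fin m) → ¬ (l ↑ˡ m ≡ k ↑ʳ t)
↑ˡ≢↑ʳ k m l t eq with trans (sym (splitAt-↑ˡ k l m)) (trans (cong (splitAt k) eq) (splitAt-↑ʳ k m t))
... | ()

e-↑ʳ : ∀ k {m} (s t : Fin m) → e (k ↑ʳ s) (k ↑ʳ t) ≡ identity s t
e-↑ʳ k s t with s ≟ t
... | yes refl = dec-true ((k ↑ʳ s) ≟ (k ↑ʳ s)) refl
... | no  s≢t  = dec-false ((k ↑ʳ s) ≟ (k ↑ʳ t)) (λ eq → s≢t (↑ʳ-injective k s t eq))

ℰ-product : ∀ {n p q} (G : Graph n) (X : Matrix p n) (Y : Matrix q n) (i : Fin p) (j : Fin q) →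
  ℰ G (X i) (Y j) ≡ (X · (adjMatrix G · (Y ᵀ))) i j
ℰ-product G X Y i j =
  Σ-cong (λ u → sym (Σ-∧ˡ (X i u) (λ v → adjMatrix G u v ∧ Y j v)))

ℰ-basis : ∀ {n p} (G : Graph n) (X : Matrix p n) (i : Fin p) (w : Fin n) →
  ℰ G (X i) (e w) ≡ (X · adjMatrix G) i w
ℰ-basis G X i w = trans (ℰ-product G X e i w)
  (·-congˡ X (≐-trans (·-congˡ (adjMatrix G) identity-sym) (·-identityʳ (adjMatrix G))) i w)

module Representatives (k m : ℕ) (G : Graph (k + m)) (red : Reducible k m G) where

  A : Matrix (k + m) (k + m)
  A = adjMatrix G

  P : Matrix k k
  P = blockP k m G

  Q : Matrix k m
  Q = blockQ k m G

  R : Matrix m m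
  R = blockR k m G

  P-sym : (P ᵀ) ≐ P
  P-sym i j = adj-sym G (j ↑ˡ m) (i ↑ˡ m)

  B : Matrix m (k + m)
  B = perpRep G red

  α : Matrix m k
  α = leftCols k m B

  -- bᵢ − v_{k+i} ∈ ⟨W⟩, so outside W the matrix B is the identity.
  B-right : rightCols k m B ≐ identity
  B-right s t with red (e (k ↑ʳ s))
  ... | a , b , a∈⟨W⟩ , _ , decomp = begin
    b (k ↑ʳ t)                        ≡⟨ cong (_xor b (k ↑ʳ t)) (a∈⟨W⟩ t) ⟨
    a (k ↑ʳ t) xor b (k ↑ʳ t)         ≡⟨ decomp (k ↑ʳ t) ⟨
    e (k ↑ʳ s) (k ↑ʳ t)               ≡⟨ e-↑ʳ k s t ⟩
    identity s t ∎
    where open ≡-Reasoning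

  -- bᵢ ∈ ⟨W⟩^⊥: the W-columns of B A vanish.
  BA-left : ∀ i l → (B · A) i (l ↑ˡ m) ≡ false
  BA-left i l = trans (sym (ℰ-basis G B i (l ↑ˡ m)))
    (proj₁ (proj₂ (proj₂ (proj₂ (red (e (k ↑ʳ i)))))) (e (l ↑ˡ m))
      (λ t → dec-false ((l ↑ˡ m) ≟ (k ↑ʳ t)) (↑ˡ≢↑ʳ k m l t)))

  BA-blocks : (B · A) ≐ ((α · topRows k m A) − bottomRows k m A)
  BA-blocks = ≐-trans (·-blocks k m B A)
    (−-cong (≐-refl {A = α · topRows k m A})
      (≐-trans (·-congʳ (bottomRows k m A) B-right) (·-identityˡ (bottomRows k m A))))

  -- Orthogonality to W, in block form: α P = Qᵀ.
  αP≐Qᵀ : (α · P) ≐ (Q ᵀ)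
  αP≐Qᵀ i l = trans
    (xor≡false⇒≡ _ _ (trans (sym (BA-blocks i (l ↑ˡ m))) (BA-left i l)))
    (adj-sym G (k ↑ʳ i) (l ↑ˡ m))

  Γ≐αQ+R : ΓAdj G red ≐ ((α · Q) − R)
  Γ≐αQ+R i j = begin
    ΓAdj G red i j                     ≡⟨ ℰ-product G B B i j ⟩
    (B · (A · (B ᵀ))) i j              ≡⟨ ·-assoc B A (B ᵀ) i j ⟨
    ((B · A) · (B ᵀ)) i j              ≡⟨ ·-blocks k m (B · A) (B ᵀ) i j ⟩
    Σ₂ (λ l → (B · A) i (l ↑ˡ m) ∧ B j (l ↑ˡ m)) xor (rightCols k m (B · A) · (rightCols k m B ᵀ)) i j
      ≡⟨ cong₂ _xor_ (trans (Σ-cong (λ l → cong (_∧ B j (l ↑ˡ m)) (BA-left i l))) (Σ-zero {k}))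
                     (·-congˡ (rightCols k m (B · A))
                        (≐-trans (λ s t → B-right t s) identity-sym) i j) ⟩
    (rightCols k m (B · A) · identity) i j
      ≡⟨ ·-identityʳ (rightCols k m (B · A)) i j ⟩
    (B · A) i (k ↑ʳ j)                 ≡⟨ BA-blocks i (k ↑ʳ j) ⟩
    ((α · Q) − R) i j ∎
    where open ≡-Reasoning

Qᵀ·M≐Mᵀ·P·M : ∀ {k m} (P : Matrix k k) (Q M : Matrix k m) →
  (P ᵀ) ≐ P → Q ≐ (P · M) → ((Q ᵀ) · M) ≐ ((M ᵀ) · (P · M))
Qᵀ·M≐Mᵀ·P·M P Q M P-sym Q≐PM = begin
  (Q ᵀ) · M              ≈⟨ ·-congʳ M (λ i j → Q≐PM j i) ⟩
  ((P · M) ᵀ) · M        ≈⟨ ·-congʳ M (ᵀ-· P M) ⟩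
  ((M ᵀ) · (P ᵀ)) · M    ≈⟨ ·-assoc (M ᵀ) (P ᵀ) M ⟩
  (M ᵀ) · ((P ᵀ) · M)    ≈⟨ ·-congˡ (M ᵀ) (·-congʳ M P-sym) ⟩
  (M ᵀ) · (P · M)        ∎
  where open SetoidReasoning (≐-setoid _ _)

α·Q≐Qᵀ·M : ∀ {k m} (P : Matrix k k) (Q M : Matrix k m) (α : Matrix m k) →
  Q ≐ (P · M) → (α · P) ≐ (Q ᵀ) → (α · Q) ≐ ((Q ᵀ) · M)
α·Q≐Qᵀ·M P Q M α Q≐PM αP≐Qᵀ = begin
  α · Q          ≈⟨ ·-congˡ α Q≐PM ⟩
  α · (P · M)    ≈⟨ ·-assoc α P M ⟨
  (α · P) · M    ≈⟨ ·-congʳ M αP≐Qᵀ ⟩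
  (Q ᵀ) · M      ∎
  where open SetoidReasoning (≐-setoid _ _)

Pinv·Q≐M : ∀ {k m} (P Pinv : Matrix k k) (Q M : Matrix k m) →
  Q ≐ (P · M) → (Pinv · P) ≐ identity → (Pinv · Q) ≐ M
Pinv·Q≐M P Pinv Q M Q≐PM left-inverse = begin
  Pinv · Q          ≈⟨ ·-congˡ Pinv Q≐PM ⟩
  Pinv · (P · M)    ≈⟨ ·-assoc Pinv P M ⟨
  (Pinv · P) · M    ≈⟨ ·-congʳ M left-inverse ⟩
  identity · M      ≈⟨ ·-identityˡ M ⟩
  M                 ∎
  where open SetoidReasoning (≐-setoid _ _)

mainTheorem4 : (k m : ℕ) (G : Graph (k + m)) (red : Reducible k m G)
    (M : Matrix k m) → blockQ k m G ≐ (blockP k m G · M) →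
    (ΓAdj G red ≐ (blockR k m G − ((M ᵀ) · (blockP k m G · M))))
    × ((Pinv : Matrix k k) → (blockP k m G · Pinv) ≐ identity → (Pinv · blockP k m G) ≐ identity →
    (blockR k m G − ((M ᵀ) · (blockP k m G · M)))
    ≐ (blockR k m G − ((blockQ k m G ᵀ) · (Pinv · blockQ k m G))))
mainTheorem4 k m G red M Q≐PM = Γ-formula , inverse-formula
  where
  open Representatives k m G red

  QᵀM≐MᵀPM : ((Q ᵀ) · M) ≐ ((M ᵀ) · (P · M))
  QᵀM≐MᵀPM = Qᵀ·M≐Mᵀ·P·M P Q M P-sym Q≐PM

  Γ-formula : ΓAdj G red ≐ (R − ((M ᵀ) · (P · M)))
  Γ-formula = ≐-trans Γ≐αQ+R (≐-trans (−-comm (α · Q) R)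
    (−-cong (≐-refl {A = R}) (≐-trans (α·Q≐Qᵀ·M P Q M α Q≐PM αP≐Qᵀ) QᵀM≐MᵀPM)))

  inverse-formula : (Pinv : Matrix k k) → (P · Pinv) ≐ identity → (Pinv · P) ≐ identity →
    (R − ((M ᵀ) · (P · M))) ≐ (R − ((Q ᵀ) · (Pinv · Q)))
  inverse-formula Pinv _ left-inverse = −-cong (≐-refl {A = R})
    (≐-sym (≐-trans (·-congˡ (Q ᵀ) (Pinv·Q≐M P Pinv Q M Q≐PM left-inverse)) QᵀM≐MᵀPM))
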